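{- For $n\ge2$, $W(LP_n)=12n^3+6n^2-3n$.
   Context: For $n\ge2$, the linear phenylene hypergraph $LP_n$ has vertex set $\{1,2,\dots,6n\}$ and $2n-1$ edges: the $n$ edges $\{6i+1,6i+2,\dots,6i+6\}$ for $i\in\{0,1,\dots,n-1\}$, and the $n-1$ edges $\{6i+5,6i+6,6i+7,6i+8\}$ for $i\in\{0,1,\dots,n-2\}$. In a hypergraph, a $u,v$-path of length $s\ge1$ is a sequence $u_0=u,e_1,u_1,\dots,e_s,u_s=v$ of pairwise distinct vertices and pairwise distinct edges with $\{u_{i-1},u_i\}\subseteq e_i$; $d(u,v)$ is the length of a shortest such path. The Wiener index $W$ is the sum of $d(u,v)$ over all unordered pairs of distinct vertices. -}

module Defs where

open import Data.Nat using (ℕ; zero; suc; _+_; _*_; _∸_; _≤_; _<_)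
open import Data.Fin using (Fin; toℕ; fromℕ; inject₁)
import Data.Fin as F
open import Data.Product using (_×_; Σ)
open import Relation.Binary.PropositionalEquality using (_≡_)

-- A hypergraph on the vertex set {1,…,V}, with an index type of edges and
-- an incidence relation (vertex v belongs to edge e).
record Hypergraph : Set₁ where
  field
    V     : ℕ
    Edge  : Set
    _∈E_  : ℕ → Edge → Set

open Hypergraph public

record Path (H : Hypergraph) (u v s : ℕ) : Set where
  field
    vert      : Fin (suc s) → ℕ
    edge      : Fin s → Edge H
    vert-inj  : ∀ i j → vert i ≡ vert j → i ≡ j
    edge-inj  : ∀ i j → edge i ≡ edge j → i ≡ j
    start     : vert F.zero ≡ u
    end       : vert (fromℕ s) ≡ v
    incident  : ∀ (i : Fin s) →
                _∈E_ H (vert (inject₁ i)) (edge i) × _∈E_ H (vert (F.suc i)) (edge i)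

IsDistance : Hypergraph → ℕ → ℕ → ℕ → Set
IsDistance H u v d = Path H u v d × (∀ s → Path H u v s → d ≤ s)

sumTo : ℕ → (ℕ → ℕ) → ℕ
sumTo zero    f = 0
sumTo (suc n) f = sumTo n f + f (suc n)

pairSum : ℕ → (ℕ → ℕ → ℕ) → ℕ
pairSum N dist = sumTo N (λ v → sumTo (v ∸ 1) (λ u → dist u v))

data LPEdge (n : ℕ) : Set where
  hex : Fin n → LPEdge n
  sq  : Fin (n ∸ 1) → LPEdge n

_∈LP_ : {n : ℕ} → ℕ → LPEdge n → Set
v ∈LP hex i = (6 * toℕ i + 1 ≤ v) × (v ≤ 6 * toℕ i + 6)
v ∈LP sq i  = (6 * toℕ i + 5 ≤ v) × (v ≤ 6 * toℕ i + 8)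

LP : ℕ → Hypergraph
LP n = record { V = 6 * n ; Edge = LPEdge n ; _∈E_ = _∈LP_ }

-- Number the edges of LP_n from left to right (hex i ↦ 2i, sq i ↦ 2i+1); every vertex lies
-- on an interval of consecutive edges.  Along a path, consecutive vertices share an edge, so
-- the index of the first edge through the current vertex grows by at most one per step; hence
-- d(u,v) ≥ 1 + (first edge of v − 1 − last edge of u).  Walking through the vertices 6i+5 and
-- 6i+8 that glue consecutive edges attains this bound.  Summing the resulting closed formula
-- block of six vertices by block gives W(LP_n) by induction on n.
module Submission where

open import Data.Empty using (⊥-elim)
open import Data.Fin using (Fin; toℕ; fromℕ; fromℕ<; inject₁)
import Data.Fin as F
open import Data.Fin.Properties using (toℕ-fromℕ<)
open import Data.Nat using (ℕ; zero; suc; pred; _+_; _*_; _∸_; _^_; _≤_; _<_; z≤n; s≤s)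
open import Data.Nat.Properties
open import Algebra.Properties.CommutativeSemigroup +-commutativeSemigroup using (interchange)
open import Data.Nat.Tactic.RingSolver using (solve-∀)
open import Data.Product using (Σ; Σ-syntax; _×_; _,_; proj₁; proj₂)
open import Function.Bundles using (_⇔_; mk⇔; Equivalence)
open import Relation.Binary.PropositionalEquality

open import Defs

-- Paths in a hypergraph

module _ {G : Hypergraph} where
  open Path

  trivial-path : ∀ v → Path G v v 0
  trivial-path v = record
    { vert = λ _ → v
    ; edge = λ ()
    ; vert-inj = λ { F.zero F.zero _ → refl }
    ; edge-inj = λ ()
    ; start = refl
    ; end = refl
    ; incident = λ ()
    }

  path-cons : ∀ {x u v s} e (p : Path G u v s) →
              (∀ i → x ≢ vert p i) → (∀ i → e ≢ edge p i) →
              _∈E_ G x e → _∈E_ G u e → Path G x v (suc s)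
  path-cons {x} {s = s} e p x∉p e∉p x∈e u∈e = record
    { vert = vert′
    ; edge = edge′
    ; vert-inj = vert′-inj
    ; edge-inj = edge′-inj
    ; start = refl
    ; end = end p
    ; incident = incident′
    }
    where
    vert′ : Fin (suc (suc s)) → ℕ
    vert′ F.zero = x
    vert′ (F.suc i) = vert p i

    edge′ : Fin (suc s) → Edge G
    edge′ F.zero = e
    edge′ (F.suc i) = edge p i

    vert′-inj : ∀ i j → vert′ i ≡ vert′ j → i ≡ j
    vert′-inj F.zero F.zero _ = refl
    vert′-inj F.zero (F.suc j) eq = ⊥-elim (x∉p j eq)
    vert′-inj (F.suc i) F.zero eq = ⊥-elim (x∉p i (sym eq))
    vert′-inj (F.suc i) (F.suc j) eq = cong F.suc (vert-inj p i j eq)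

    edge′-inj : ∀ i j → edge′ i ≡ edge′ j → i ≡ j
    edge′-inj F.zero F.zero _ = refl
    edge′-inj F.zero (F.suc j) eq = ⊥-elim (e∉p j eq)
    edge′-inj (F.suc i) F.zero eq = ⊥-elim (e∉p i (sym eq))
    edge′-inj (F.suc i) (F.suc j) eq = cong F.suc (edge-inj p i j eq)

    incident′ : ∀ i → _∈E_ G (vert′ (inject₁ i)) (edge′ i) × _∈E_ G (vert′ (F.suc i)) (edge′ i)
    incident′ F.zero = x∈e , subst (λ w → _∈E_ G w e) (sym (start p)) u∈e
    incident′ (F.suc i) = incident p i

-- The edges through a vertex of LP_n

pattern suc⁶ y = suc (suc (suc (suc (suc (suc y)))))
pattern s≤s⁶ p = s≤s (s≤s (s≤s (s≤s (s≤s (s≤s p)))))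

-- A vertex x ≥ 1 lies on the edges of index k (see `index`) with lo x ≤ k + 1 and k ≤ hi x.
-- Both are computed 6-periodically, so lo 1 = lo 2 = 0: those vertices lie on the square of
-- index -1 of the periodic extension.
hi : ℕ → ℕ
hi 0 = 0
hi 1 = 0
hi 2 = 0
hi 3 = 0
hi 4 = 0
hi 5 = 1
hi 6 = 1
hi (suc⁶ (suc y)) = 2 + hi (suc y)

lo : ℕ → ℕ
lo 0 = 0
lo 1 = 0
lo 2 = 0
lo 3 = 1
lo 4 = 1
lo 5 = 1
lo 6 = 1
lo (suc⁶ (suc y)) = 2 + lo (suc y)

hi≤lo : ∀ x → hi x ≤ lo x
hi≤lo 0 = z≤n
hi≤lo 1 = z≤n
hi≤lo 2 = z≤n
hi≤lo 3 = z≤n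
hi≤lo 4 = z≤n
hi≤lo 5 = s≤s z≤n
hi≤lo 6 = s≤s z≤n
hi≤lo (suc⁶ (suc y)) = s≤s (s≤s (hi≤lo (suc y)))

lo≤1+hi : ∀ x → lo x ≤ suc (hi x)
lo≤1+hi 0 = z≤n
lo≤1+hi 1 = z≤n
lo≤1+hi 2 = z≤n
lo≤1+hi 3 = s≤s z≤n
lo≤1+hi 4 = s≤s z≤n
lo≤1+hi 5 = s≤s z≤n
lo≤1+hi 6 = s≤s z≤n
lo≤1+hi (suc⁶ (suc y)) = s≤s (s≤s (lo≤1+hi (suc y)))

lo≤lo-suc : ∀ x → lo x ≤ lo (suc x)
lo≤lo-suc 0 = z≤n
lo≤lo-suc 1 = z≤n
lo≤lo-suc 2 = z≤n
lo≤lo-suc 3 = s≤s z≤n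
lo≤lo-suc 4 = s≤s z≤n
lo≤lo-suc 5 = s≤s z≤n
lo≤lo-suc 6 = s≤s z≤n
lo≤lo-suc (suc⁶ (suc y)) = s≤s (s≤s (lo≤lo-suc (suc y)))

lo-mono-≤ : ∀ {x y} → x ≤ y → lo x ≤ lo y
lo-mono-≤ {x} x≤y with m≤n⇒∃[o]m+o≡n x≤y
... | k , refl = go k
  where
  go : ∀ k → lo x ≤ lo (x + k)
  go zero = ≤-reflexive (cong lo (sym (+-identityʳ x)))
  go (suc k) = ≤-trans (go k) (subst (λ y → lo (x + k) ≤ lo y) (sym (+-suc x k)) (lo≤lo-suc (x + k)))

-- Vertex 5 + 3k is shared by the edges of index k and k + 1 (it is 6i+5 or 6i+8).
mid : ℕ → ℕ
mid k = 5 + k * 3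

hi-mid : ∀ k → hi (mid k) ≡ suc k
hi-mid 0 = refl
hi-mid 1 = refl
hi-mid (suc (suc k)) = cong (2 +_) (hi-mid k)

lo-mid : ∀ k → lo (mid k) ≡ suc k
lo-mid 0 = refl
lo-mid 1 = refl
lo-mid (suc (suc k)) = cong (2 +_) (lo-mid k)

x<mid[hi[x]] : ∀ x → x < mid (hi x)
x<mid[hi[x]] 0 = s≤s z≤n
x<mid[hi[x]] 1 = s≤s (s≤s z≤n)
x<mid[hi[x]] 2 = s≤s (s≤s (s≤s z≤n))
x<mid[hi[x]] 3 = s≤s (s≤s (s≤s (s≤s z≤n)))
x<mid[hi[x]] 4 = s≤s (s≤s (s≤s (s≤s (s≤s z≤n))))
x<mid[hi[x]] 5 = s≤s⁶ z≤n
x<mid[hi[x]] 6 = s≤s⁶ (s≤s z≤n)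
x<mid[hi[x]] (suc⁶ (suc y)) = s≤s⁶ (x<mid[hi[x]] (suc y))

lo[x]*3≤x : ∀ x → lo x * 3 ≤ x
lo[x]*3≤x 0 = z≤n
lo[x]*3≤x 1 = z≤n
lo[x]*3≤x 2 = z≤n
lo[x]*3≤x 3 = ≤-refl
lo[x]*3≤x 4 = s≤s (s≤s (s≤s z≤n))
lo[x]*3≤x 5 = s≤s (s≤s (s≤s z≤n))
lo[x]*3≤x 6 = s≤s (s≤s (s≤s z≤n))
lo[x]*3≤x (suc⁶ (suc y)) = s≤s⁶ (lo[x]*3≤x (suc y))

periodic-shift : (f : ℕ → ℕ) → (∀ y → f (suc⁶ (suc y)) ≡ 2 + f (suc y)) →
                 ∀ m x → f (suc x + m * 6) ≡ f (suc x) + m * 2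
periodic-shift f step zero x = trans (cong f (+-identityʳ (suc x))) (sym (+-identityʳ (f (suc x))))
periodic-shift f step (suc m) x = begin
  f (suc x + suc m * 6)         ≡⟨ cong f (a+[6+b]≡6+[a+b] (suc x) (m * 6)) ⟩
  f (suc⁶ (suc x + m * 6))      ≡⟨ step (x + m * 6) ⟩
  2 + f (suc x + m * 6)         ≡⟨ cong (2 +_) (periodic-shift f step m x) ⟩
  2 + (f (suc x) + m * 2)       ≡⟨ +-assoc-comm 2 (f (suc x)) (m * 2) ⟩
  f (suc x) + suc m * 2         ∎
  where
  open ≡-Reasoning
  a+[6+b]≡6+[a+b] : ∀ a b → a + (6 + b) ≡ 6 + (a + b)
  a+[6+b]≡6+[a+b] = solve-∀
  +-assoc-comm : ∀ a b c → a + (b + c) ≡ b + (a + c)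
  +-assoc-comm = solve-∀

hi-shift : ∀ m x → hi (suc x + m * 6) ≡ hi (suc x) + m * 2
hi-shift = periodic-shift hi (λ _ → refl)

lo-shift : ∀ m x → lo (suc x + m * 6) ≡ lo (suc x) + m * 2
lo-shift = periodic-shift lo (λ _ → refl)

hex-start : ∀ i x → 1 ≤ x → (suc (i * 6) ≤ x ⇔ i * 2 ≤ hi x)
hex-start i x 1≤x = mk⇔ (to i x) (from i x 1≤x)
  where
  to : ∀ i x → suc (i * 6) ≤ x → i * 2 ≤ hi x
  to zero x _ = z≤n
  to (suc i) (suc⁶ (suc y)) (s≤s⁶ p) = s≤s (s≤s (to i (suc y) p))

  from : ∀ i x → 1 ≤ x → i * 2 ≤ hi x → suc (i * 6) ≤ x
  from zero x 1≤x _ = 1≤x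
  from (suc i) 5 _ (s≤s ())
  from (suc i) 6 _ (s≤s ())
  from (suc i) (suc⁶ (suc y)) _ (s≤s (s≤s p)) = s≤s⁶ (from i (suc y) (s≤s z≤n) p)

hex-end : ∀ i x → (x ≤ 6 + i * 6 ⇔ lo x ≤ suc (i * 2))
hex-end i x = mk⇔ (to i x) (from i x)
  where
  to : ∀ i x → x ≤ 6 + i * 6 → lo x ≤ suc (i * 2)
  to i 0 _ = z≤n
  to i 1 _ = z≤n
  to i 2 _ = z≤n
  to i 3 _ = s≤s z≤n
  to i 4 _ = s≤s z≤n
  to i 5 _ = s≤s z≤n
  to i 6 _ = s≤s z≤n
  to zero (suc⁶ (suc y)) (s≤s⁶ ())
  to (suc i) (suc⁶ (suc y)) (s≤s⁶ p) = s≤s (s≤s (to i (suc y) p))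

  from : ∀ i x → lo x ≤ suc (i * 2) → x ≤ 6 + i * 6
  from i 0 _ = z≤n
  from i 1 _ = s≤s z≤n
  from i 2 _ = s≤s (s≤s z≤n)
  from i 3 _ = s≤s (s≤s (s≤s z≤n))
  from i 4 _ = s≤s (s≤s (s≤s (s≤s z≤n)))
  from i 5 _ = s≤s (s≤s (s≤s (s≤s (s≤s z≤n))))
  from i 6 _ = s≤s⁶ z≤n
  from zero (suc⁶ (suc y)) (s≤s ())
  from (suc i) (suc⁶ (suc y)) (s≤s (s≤s p)) = s≤s⁶ (from i (suc y) p)

sq-start : ∀ i x → (5 + i * 6 ≤ x ⇔ suc (i * 2) ≤ hi x)
sq-start i x = mk⇔ (to i x) (from i x)
  where
  to : ∀ i x → 5 + i * 6 ≤ x → suc (i * 2) ≤ hi x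
  to zero 1 (s≤s ())
  to zero 2 (s≤s (s≤s ()))
  to zero 3 (s≤s (s≤s (s≤s ())))
  to zero 4 (s≤s (s≤s (s≤s (s≤s ()))))
  to zero 5 _ = s≤s z≤n
  to zero 6 _ = s≤s z≤n
  to zero (suc⁶ (suc y)) _ = s≤s z≤n
  to (suc i) (suc⁶ (suc y)) (s≤s⁶ p) = s≤s (s≤s (to i (suc y) p))

  from : ∀ i x → suc (i * 2) ≤ hi x → 5 + i * 6 ≤ x
  from zero 5 _ = s≤s (s≤s (s≤s (s≤s (s≤s z≤n))))
  from zero 6 _ = s≤s (s≤s (s≤s (s≤s (s≤s z≤n))))
  from zero (suc⁶ (suc y)) _ = s≤s (s≤s (s≤s (s≤s (s≤s z≤n))))
  from (suc i) 5 (s≤s ())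
  from (suc i) 6 (s≤s ())
  from (suc i) (suc⁶ (suc y)) (s≤s (s≤s p)) = s≤s⁶ (from i (suc y) p)

sq-end : ∀ i x → (x ≤ 8 + i * 6 ⇔ lo x ≤ 2 + i * 2)
sq-end i x = mk⇔ (to i x) (from i x)
  where
  to : ∀ i x → x ≤ 8 + i * 6 → lo x ≤ 2 + i * 2
  to i 0 _ = z≤n
  to i 1 _ = z≤n
  to i 2 _ = z≤n
  to i 3 _ = s≤s z≤n
  to i 4 _ = s≤s z≤n
  to i 5 _ = s≤s z≤n
  to i 6 _ = s≤s z≤n
  to zero 7 _ = s≤s (s≤s z≤n)
  to zero 8 _ = s≤s (s≤s z≤n)
  to zero (suc⁶ (suc (suc (suc (suc y))))) (s≤s⁶ (s≤s (s≤s ())))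
  to (suc i) (suc⁶ (suc y)) (s≤s⁶ p) = s≤s (s≤s (to i (suc y) p))

  lo≤0⇒x≤2 : ∀ x → lo x ≤ 0 → x ≤ 2
  lo≤0⇒x≤2 0 _ = z≤n
  lo≤0⇒x≤2 1 _ = s≤s z≤n
  lo≤0⇒x≤2 2 _ = s≤s (s≤s z≤n)
  lo≤0⇒x≤2 3 ()
  lo≤0⇒x≤2 4 ()
  lo≤0⇒x≤2 5 ()
  lo≤0⇒x≤2 6 ()
  lo≤0⇒x≤2 (suc⁶ (suc y)) ()

  from : ∀ i x → lo x ≤ 2 + i * 2 → x ≤ 8 + i * 6
  from i 0 _ = z≤n
  from i 1 _ = s≤s z≤n
  from i 2 _ = s≤s (s≤s z≤n)
  from i 3 _ = s≤s (s≤s (s≤s z≤n))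
  from i 4 _ = s≤s (s≤s (s≤s (s≤s z≤n)))
  from i 5 _ = s≤s (s≤s (s≤s (s≤s (s≤s z≤n))))
  from i 6 _ = s≤s⁶ z≤n
  from zero (suc⁶ (suc y)) (s≤s (s≤s p)) = s≤s⁶ (lo≤0⇒x≤2 (suc y) p)
  from (suc i) (suc⁶ (suc y)) (s≤s (s≤s p)) = s≤s⁶ (from i (suc y) p)

index : ∀ {n} → LPEdge n → ℕ
index (hex i) = toℕ i * 2
index (sq i) = suc (toℕ i * 2)

OnEdge : ℕ → ℕ → Set
OnEdge x k = 1 ≤ x × lo x ≤ suc k × k ≤ hi x

6*i+c≡c+i*6 : ∀ i c → 6 * i + c ≡ c + i * 6
6*i+c≡c+i*6 = solve-∀

∈LP⇒OnEdge : ∀ {n} x (e : LPEdge n) → x ∈LP e → OnEdge x (index e)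
∈LP⇒OnEdge x (hex i) (start , end) =
  1≤x , Equivalence.to (hex-end (toℕ i) x) (subst (x ≤_) (6*i+c≡c+i*6 (toℕ i) 6) end)
      , Equivalence.to (hex-start (toℕ i) x 1≤x) start′
  where
  start′ = subst (_≤ x) (6*i+c≡c+i*6 (toℕ i) 1) start
  1≤x = ≤-trans (s≤s z≤n) start′
∈LP⇒OnEdge x (sq i) (start , end) =
  ≤-trans (s≤s z≤n) start′ , Equivalence.to (sq-end (toℕ i) x) (subst (x ≤_) (6*i+c≡c+i*6 (toℕ i) 8) end)
                           , Equivalence.to (sq-start (toℕ i) x) start′
  where
  start′ = subst (_≤ x) (6*i+c≡c+i*6 (toℕ i) 5) start

OnEdge⇒∈LP : ∀ {n} x (e : LPEdge n) → OnEdge x (index e) → x ∈LP e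
OnEdge⇒∈LP x (hex i) (1≤x , lo≤ , ≤hi) =
  subst (_≤ x) (sym (6*i+c≡c+i*6 (toℕ i) 1)) (Equivalence.from (hex-start (toℕ i) x 1≤x) ≤hi) ,
  subst (x ≤_) (sym (6*i+c≡c+i*6 (toℕ i) 6)) (Equivalence.from (hex-end (toℕ i) x) lo≤)
OnEdge⇒∈LP x (sq i) (_ , lo≤ , ≤hi) =
  subst (_≤ x) (sym (6*i+c≡c+i*6 (toℕ i) 5)) (Equivalence.from (sq-start (toℕ i) x) ≤hi) ,
  subst (x ≤_) (sym (6*i+c≡c+i*6 (toℕ i) 8)) (Equivalence.from (sq-end (toℕ i) x) lo≤)

OnEdge-step : ∀ {a b k} → OnEdge a k → OnEdge b k → lo b ≤ suc (hi a)
OnEdge-step (_ , _ , k≤hi[a]) (_ , lo[b]≤1+k , _) = ≤-trans lo[b]≤1+k (s≤s k≤hi[a])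

OnEdge-mid : ∀ k → OnEdge (mid k) k
OnEdge-mid k = s≤s z≤n , ≤-reflexive (lo-mid k) , subst (k ≤_) (sym (hi-mid k)) (n≤1+n k)

OnEdge-mid-suc : ∀ k → OnEdge (mid k) (suc k)
OnEdge-mid-suc k = s≤s z≤n , subst (_≤ 2 + k) (sym (lo-mid k)) (n≤1+n (suc k)) , ≤-reflexive (sym (hi-mid k))

data Parity : ℕ → Set where
  even : ∀ i → Parity (i * 2)
  odd  : ∀ i → Parity (suc (i * 2))

parity : ∀ k → Parity k
parity zero = even 0
parity (suc k) with parity k
... | even i = odd i
... | odd i = even (suc i)

hex-bound : ∀ {i} n → suc (suc (i * 2)) ≤ n * 2 → i < n
hex-bound {i} n p = *-cancelʳ-< 2 i n (≤-trans (n≤1+n _) p)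

sq-bound : ∀ {i} n → suc (suc (suc (i * 2))) ≤ n * 2 → i < n ∸ 1
sq-bound {i} (suc n) p = ≤-pred (*-cancelʳ-< 2 (suc i) (suc n) p)

edgeAt′ : ∀ n {k} → Parity k → suc (suc k) ≤ n * 2 → LPEdge n
edgeAt′ n (even i) p = hex (fromℕ< (hex-bound {i} n p))
edgeAt′ n (odd i) p = sq (fromℕ< (sq-bound {i} n p))

index-edgeAt′ : ∀ n {k} (pk : Parity k) p → index (edgeAt′ n pk p) ≡ k
index-edgeAt′ n (even i) p = cong (_* 2) (toℕ-fromℕ< (hex-bound {i} n p))
index-edgeAt′ n (odd i) p = cong (λ j → suc (j * 2)) (toℕ-fromℕ< (sq-bound {i} n p))

edgeAt : ∀ n k → suc (suc k) ≤ n * 2 → LPEdge n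
edgeAt n k = edgeAt′ n (parity k)

index-edgeAt : ∀ n k p → index (edgeAt n k p) ≡ k
index-edgeAt n k = index-edgeAt′ n (parity k)

OnEdge⇒∈edgeAt : ∀ {n x k} p → OnEdge x k → x ∈LP edgeAt n k p
OnEdge⇒∈edgeAt {n} {x} {k} p x∈k = OnEdge⇒∈LP x (edgeAt n k p) (subst (OnEdge x) (sym (index-edgeAt n k p)) x∈k)

-- Shortest paths

mid<mid-suc : ∀ k → mid k < mid (suc k)
mid<mid-suc k = +-monoʳ-< 5 (m<n+m (k * 3) (s≤s z≤n))

Ascending : ℕ → ℕ → ℕ → ℕ → Set
Ascending zero c u v = u < v
Ascending (suc s) c u v = u < mid c × Ascending s (suc c) (mid c) v

ascending : ∀ s {c u v} → u < mid c → mid (s + c) < v → Ascending (suc s) c u v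
ascending zero u<mid mid<v = u<mid , mid<v
ascending (suc s) {c} {v = v} u<mid mid<v =
  u<mid , ascending s (mid<mid-suc c) (subst (λ k → mid k < v) (sym (+-suc s c)) mid<v)

climb : ∀ {n} s c {u v} → OnEdge u c → OnEdge v (s + c) → Ascending s c u v →
        (bound : suc (suc (s + c)) ≤ n * 2) →
        Σ[ p ∈ Path (LP n) u v (suc s) ] (∀ i → u ≤ Path.vert p i) × (∀ i → c ≤ index (Path.edge p i))
climb {n} zero c {u} {v} u∈c v∈c u<v bound =
  path-cons e (trivial-path v) (λ _ → <⇒≢ u<v) (λ ())
            (OnEdge⇒∈edgeAt bound u∈c) (OnEdge⇒∈edgeAt bound v∈c) ,
  above , right
  where
  e = edgeAt n c bound

  above : ∀ i → u ≤ _
  above F.zero = ≤-refl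
  above (F.suc _) = <⇒≤ u<v

  right : ∀ i → c ≤ _
  right F.zero = ≤-reflexive (sym (index-edgeAt n c bound))
climb {n} (suc s) c {u} {v} u∈c v∈ (u<mid , ascending) bound =
  path-cons e p (λ i → <⇒≢ (<-≤-trans u<mid (p-above i))) e∉p
            (OnEdge⇒∈edgeAt e-bound u∈c) (OnEdge⇒∈edgeAt e-bound (OnEdge-mid c)) ,
  above , right
  where
  tail = climb s (suc c) (OnEdge-mid-suc c) (subst (OnEdge v) (sym (+-suc s c)) v∈) ascending
               (subst (λ k → suc (suc k) ≤ n * 2) (sym (+-suc s c)) bound)
  p = proj₁ tail
  p-above = proj₁ (proj₂ tail)
  p-right = proj₂ (proj₂ tail)

  e-bound : suc (suc c) ≤ n * 2
  e-bound = ≤-trans (s≤s (s≤s (m≤n+m c (suc s)))) bound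

  e = edgeAt n c e-bound

  e∉p : ∀ i → e ≢ Path.edge p i
  e∉p i e≡ = <⇒≢ (p-right i) (trans (sym (index-edgeAt n c e-bound)) (cong index e≡))

  above : ∀ i → u ≤ _
  above F.zero = ≤-refl
  above (F.suc i) = ≤-trans (<⇒≤ u<mid) (p-above i)

  right : ∀ i → c ≤ _
  right F.zero = ≤-reflexive (sym (index-edgeAt n c e-bound))
  right (F.suc i) = ≤-trans (n≤1+n c) (p-right i)

lo<n*2 : ∀ n {v} → 1 ≤ v → v ≤ n * 6 → lo v < n * 2
lo<n*2 zero {suc _} _ ()
lo<n*2 (suc n) {v} _ v≤ = s≤s (Equivalence.to (hex-end n v) v≤)

lo∸1<n*2 : ∀ n {v} → 1 ≤ v → v ≤ n * 6 → suc (lo v ∸ 1) < n * 2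
lo∸1<n*2 zero {suc _} _ ()
lo∸1<n*2 (suc n) {v} _ v≤ = s≤s (s≤s (∸-monoˡ-≤ 1 (Equivalence.to (hex-end n v) v≤)))

distance : ℕ → ℕ → ℕ
distance u v = suc (lo v ∸ suc (hi u))

distance-path : ∀ n {u v} → 1 ≤ u → u < v → v ≤ n * 6 → Path (LP n) u v (distance u v)
distance-path n {u} {v} 1≤u u<v v≤ = path (lo v ∸ suc (hi u)) refl
  where
  1≤v = ≤-trans 1≤u (<⇒≤ u<v)

  path : ∀ s → lo v ∸ suc (hi u) ≡ s → Path (LP n) u v (suc s)
  path zero eq = proj₁ (climb 0 (lo v ∸ 1) u∈ v∈ u<v (lo∸1<n*2 n 1≤v v≤))
    where
    lo[v]≤1+c = m≤n+m∸n (lo v) 1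
    lo[v]≤1+hi[u] : lo v ≤ suc (hi u)
    lo[v]≤1+hi[u] = m∸n≡0⇒m≤n eq
    u∈ : OnEdge u (lo v ∸ 1)
    u∈ = 1≤u , ≤-trans (lo-mono-≤ (<⇒≤ u<v)) lo[v]≤1+c , ∸-monoˡ-≤ 1 lo[v]≤1+hi[u]
    v∈ : OnEdge v (lo v ∸ 1)
    v∈ = 1≤v , lo[v]≤1+c , ∸-monoˡ-≤ 1 (lo≤1+hi v)
  path (suc s) eq = proj₁ (climb (suc s) (hi u) u∈ v∈ (ascending s (x<mid[hi[x]] u) mid<v)
                                 (subst (_< n * 2) lo[v]≡ (lo<n*2 n 1≤v v≤)))
    where
    lo[v]≡ : lo v ≡ suc (suc (s + hi u))
    lo[v]≡ = begin
      lo v                               ≡⟨ m∸n+n≡m (<⇒≤ (m∸n≢0⇒n<m {lo v} {suc (hi u)} (λ eq₀ → 0≢1+n (trans (sym eq₀) eq)))) ⟨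
      (lo v ∸ suc (hi u)) + suc (hi u)   ≡⟨ cong (_+ suc (hi u)) eq ⟩
      suc s + suc (hi u)                 ≡⟨ cong suc (+-suc s (hi u)) ⟩
      suc (suc (s + hi u))               ∎
      where open ≡-Reasoning
    u∈ = 1≤u , lo≤1+hi u , ≤-refl
    v∈ = 1≤v , ≤-reflexive lo[v]≡ , ≤-pred (subst (_≤ suc (hi v)) lo[v]≡ (lo≤1+hi v))
    mid<v : mid (s + hi u) < v
    mid<v = subst (λ l → l * 3 ≤ v) lo[v]≡ (lo[x]*3≤x v)

lo-walk : ∀ s (w : Fin (suc (suc s)) → ℕ) → (∀ i → lo (w (F.suc i)) ≤ suc (hi (w (inject₁ i)))) →
          lo (w (fromℕ (suc s))) ≤ s + suc (hi (w F.zero))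
lo-walk zero w step = step F.zero
lo-walk (suc s) w step =
  ≤-trans (step (fromℕ (suc s)))
          (s≤s (≤-trans (hi≤lo (w (inject₁ (fromℕ (suc s))))) (lo-walk s (λ i → w (inject₁ i)) (λ i → step (inject₁ i)))))

distance-minimal : ∀ {n u v s} → u < v → Path (LP n) u v s → distance u v ≤ s
distance-minimal {s = zero} u<v p = ⊥-elim (<⇒≢ u<v (trans (sym (Path.start p)) (Path.end p)))
distance-minimal {u = u} {v} {suc s} u<v p =
  s≤s (m≤n+o⇒m∸n≤o (lo v) (suc (hi u))
        (subst₂ (λ a b → lo b ≤ suc (hi a) + s) (Path.start p) (Path.end p)
                (subst (lo (Path.vert p (fromℕ (suc s))) ≤_) (+-comm s _) (lo-walk s (Path.vert p) step))))
  where
  step : ∀ i → lo (Path.vert p (F.suc i)) ≤ suc (hi (Path.vert p (inject₁ i)))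
  step i = OnEdge-step (∈LP⇒OnEdge _ _ (proj₁ (Path.incident p i)))
                       (∈LP⇒OnEdge _ _ (proj₂ (Path.incident p i)))

-- The Wiener index

sumTo-cong : ∀ N {f g} → (∀ u → 1 ≤ u → u ≤ N → f u ≡ g u) → sumTo N f ≡ sumTo N g
sumTo-cong zero _ = refl
sumTo-cong (suc N) f≡g =
  cong₂ _+_ (sumTo-cong N (λ u 1≤u u≤N → f≡g u 1≤u (m≤n⇒m≤1+n u≤N))) (f≡g (suc N) (s≤s z≤n) ≤-refl)

sumTo-+ : ∀ N f g → sumTo N (λ u → f u + g u) ≡ sumTo N f + sumTo N g
sumTo-+ zero f g = refl
sumTo-+ (suc N) f g =
  trans (cong (_+ (f (suc N) + g (suc N))) (sumTo-+ N f g))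
        (interchange (sumTo N f) (sumTo N g) (f (suc N)) (g (suc N)))

sumTo-const : ∀ N c → sumTo N (λ _ → c) ≡ N * c
sumTo-const zero c = refl
sumTo-const (suc N) c = trans (cong (_+ c) (sumTo-const N c)) (+-comm (N * c) c)

sumTo-split : ∀ k N f → sumTo (k + N) f ≡ sumTo N f + sumTo k (λ j → f (j + N))
sumTo-split zero N f = sym (+-identityʳ (sumTo N f))
sumTo-split (suc k) N f =
  trans (cong (_+ f (suc (k + N))) (sumTo-split k N f)) (+-assoc (sumTo N f) _ _)

sumTo-hi : ∀ m → sumTo (m * 6) hi + m * 4 ≡ m * m * 6
sumTo-hi zero = refl
sumTo-hi (suc m) = begin
  sumTo (6 + m * 6) hi + suc m * 4
    ≡⟨ cong (_+ suc m * 4) (sumTo-split 6 (m * 6) hi) ⟩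
  sumTo (m * 6) hi + sumTo 6 (λ j → hi (j + m * 6)) + suc m * 4
    ≡⟨ cong (λ b → sumTo (m * 6) hi + b + suc m * 4) last-block ⟩
  sumTo (m * 6) hi + (2 + 6 * (m * 2)) + suc m * 4
    ≡⟨ regroup (sumTo (m * 6) hi) m ⟩
  sumTo (m * 6) hi + m * 4 + (6 + m * 12)
    ≡⟨ cong (_+ (6 + m * 12)) (sumTo-hi m) ⟩
  m * m * 6 + (6 + m * 12)
    ≡⟨ square m ⟩
  suc m * suc m * 6 ∎
  where
  open ≡-Reasoning
  last-block : sumTo 6 (λ j → hi (j + m * 6)) ≡ 2 + 6 * (m * 2)
  last-block = begin
    sumTo 6 (λ j → hi (j + m * 6))         ≡⟨ sumTo-cong 6 {λ j → hi (j + m * 6)} {λ j → hi j + m * 2} (λ { zero () _ ; (suc j) _ _ → hi-shift m j }) ⟩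
    sumTo 6 (λ j → hi j + m * 2)           ≡⟨ sumTo-+ 6 hi (λ _ → m * 2) ⟩
    sumTo 6 hi + sumTo 6 (λ _ → m * 2)     ≡⟨ cong (2 +_) (sumTo-const 6 (m * 2)) ⟩
    2 + 6 * (m * 2)                        ∎
  regroup : ∀ a m → a + (2 + 6 * (m * 2)) + suc m * 4 ≡ a + m * 4 + (6 + m * 12)
  regroup = solve-∀
  square : ∀ m → m * m * 6 + (6 + m * 12) ≡ suc m * suc m * 6
  square = solve-∀

distance+hi : ∀ u v → suc (hi u) ≤ lo v → distance u v + hi u ≡ lo v
distance+hi u v 1+hi[u]≤lo[v] =
  trans (sym (+-suc (lo v ∸ suc (hi u)) (hi u))) (m∸n+n≡m 1+hi[u]≤lo[v])

distance≡1 : ∀ u v → lo v ≤ suc (hi u) → distance u v ≡ 1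
distance≡1 u v lo[v]≤1+hi[u] = cong suc (m≤n⇒m∸n≡0 lo[v]≤1+hi[u])

sumTo-distance+sumTo-hi : ∀ n v → n * 2 ≤ lo v →
                          sumTo (n * 6) (λ u → distance u v) + sumTo (n * 6) hi ≡ n * 6 * lo v
sumTo-distance+sumTo-hi n v n*2≤lo[v] = begin
  sumTo (n * 6) (λ u → distance u v) + sumTo (n * 6) hi ≡⟨ sumTo-+ (n * 6) (λ u → distance u v) hi ⟨
  sumTo (n * 6) (λ u → distance u v + hi u)             ≡⟨ sumTo-cong (n * 6) pointwise ⟩
  sumTo (n * 6) (λ _ → lo v)                            ≡⟨ sumTo-const (n * 6) (lo v) ⟩
  n * 6 * lo v                                          ∎
  where
  open ≡-Reasoning
  pointwise : ∀ u → 1 ≤ u → u ≤ n * 6 → distance u v + hi u ≡ lo v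
  pointwise u 1≤u u≤ = distance+hi u v (≤-trans (s≤s (hi≤lo u)) (≤-trans (lo<n*2 n 1≤u u≤) n*2≤lo[v]))

lo-block≤1+hi : ∀ n k j → k ≤ 5 → lo (suc k + n * 6) ≤ suc (hi (suc j + n * 6))
lo-block≤1+hi n k j k≤5 = begin
  lo (suc k + n * 6)         ≡⟨ lo-shift n k ⟩
  lo (suc k) + n * 2         ≤⟨ +-monoˡ-≤ (n * 2) (Equivalence.to (hex-end 0 (suc k)) (s≤s k≤5)) ⟩
  suc (n * 2)                ≤⟨ s≤s (m≤n+m (n * 2) (hi (suc j))) ⟩
  suc (hi (suc j) + n * 2)   ≡⟨ cong suc (hi-shift n j) ⟨
  suc (hi (suc j + n * 6))   ∎
  where open ≤-Reasoning

distance-column : ∀ n k → k ≤ 5 →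
  sumTo (k + n * 6) (λ u → distance u (suc k + n * 6)) ≡ n * 6 * lo (suc k) + n * n * 6 + n * 4 + k
distance-column n k k≤5 = begin
  sumTo (k + n * 6) (λ u → distance u v)
    ≡⟨ sumTo-split k (n * 6) (λ u → distance u v) ⟩
  sumTo (n * 6) (λ u → distance u v) + sumTo k (λ j → distance (j + n * 6) v)
    ≡⟨ cong₂ _+_ earlier-blocks same-block ⟩
  n * 6 * ℓ + n * n * 6 + n * 4 + k ∎
  where
  open ≡-Reasoning
  v = suc k + n * 6
  ℓ = lo (suc k)

  lo[v]≡ : lo v ≡ ℓ + n * 2
  lo[v]≡ = lo-shift n k

  same-block : sumTo k (λ j → distance (j + n * 6) v) ≡ k
  same-block = begin
    sumTo k (λ j → distance (j + n * 6) v) ≡⟨ sumTo-cong k (λ { zero () _ ; (suc j) _ _ → distance≡1 (suc j + n * 6) v (lo-block≤1+hi n k j k≤5) }) ⟩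
    sumTo k (λ _ → 1)                      ≡⟨ sumTo-const k 1 ⟩
    k * 1                                  ≡⟨ *-identityʳ k ⟩
    k                                      ∎

  earlier-blocks : sumTo (n * 6) (λ u → distance u v) ≡ n * 6 * ℓ + n * n * 6 + n * 4
  earlier-blocks = +-cancelʳ-≡ S _ _ (begin
    sumTo (n * 6) (λ u → distance u v) + S
      ≡⟨ sumTo-distance+sumTo-hi n v (subst (n * 2 ≤_) (sym lo[v]≡) (m≤n+m (n * 2) ℓ)) ⟩
    n * 6 * lo v                           ≡⟨ cong (n * 6 *_) lo[v]≡ ⟩
    n * 6 * (ℓ + n * 2)                    ≡⟨ expand n ℓ ⟩
    n * 6 * ℓ + n * n * 6 + n * n * 6      ≡⟨ cong (n * 6 * ℓ + n * n * 6 +_) (sumTo-hi n) ⟨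
    n * 6 * ℓ + n * n * 6 + (S + n * 4)    ≡⟨ regroup (n * 6 * ℓ + n * n * 6) S (n * 4) ⟩
    n * 6 * ℓ + n * n * 6 + n * 4 + S      ∎)
    where
    S = sumTo (n * 6) hi
    expand : ∀ n ℓ → n * 6 * (ℓ + n * 2) ≡ n * 6 * ℓ + n * n * 6 + n * n * 6
    expand = solve-∀
    regroup : ∀ a b c → a + (b + c) ≡ a + c + b
    regroup = solve-∀

six-columns : ∀ n → sumTo 6 (λ j → n * 6 * lo j + n * n * 6 + n * 4 + pred j) ≡ n * n * 36 + n * 48 + 15
six-columns n = unfolded n
  where
  unfolded : ∀ n → (n * 6 * 0 + n * n * 6 + n * 4 + 0) + (n * 6 * 0 + n * n * 6 + n * 4 + 1)
                 + (n * 6 * 1 + n * n * 6 + n * 4 + 2) + (n * 6 * 1 + n * n * 6 + n * 4 + 3)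
                 + (n * 6 * 1 + n * n * 6 + n * 4 + 4) + (n * 6 * 1 + n * n * 6 + n * 4 + 5)
                 ≡ n * n * 36 + n * 48 + 15
  unfolded = solve-∀

wiener-step : ∀ n → pairSum (suc n * 6) distance ≡ pairSum (n * 6) distance + (n * n * 36 + n * 48 + 15)
wiener-step n = begin
  sumTo (6 + n * 6) column                                  ≡⟨ sumTo-split 6 (n * 6) column ⟩
  pairSum (n * 6) distance + sumTo 6 (λ j → column (j + n * 6))
    ≡⟨ cong (pairSum (n * 6) distance +_) (sumTo-cong 6 {λ j → column (j + n * 6)} {λ j → n * 6 * lo j + n * n * 6 + n * 4 + pred j}
                                                 (λ { zero () _ ; (suc k) _ k<6 → distance-column n k (≤-pred k<6) })) ⟩
  pairSum (n * 6) distance + sumTo 6 (λ j → n * 6 * lo j + n * n * 6 + n * 4 + pred j)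
    ≡⟨ cong (pairSum (n * 6) distance +_) (six-columns n) ⟩
  pairSum (n * 6) distance + (n * n * 36 + n * 48 + 15)     ∎
  where
  open ≡-Reasoning
  column : ℕ → ℕ
  column v = sumTo (v ∸ 1) (λ u → distance u v)

wiener : ∀ n → pairSum (n * 6) distance + 3 * n ≡ n * n * n * 12 + n * n * 6
wiener zero = refl
wiener (suc n) = begin
  pairSum (suc n * 6) distance + 3 * suc n
    ≡⟨ cong (_+ 3 * suc n) (wiener-step n) ⟩
  pairSum (n * 6) distance + (n * n * 36 + n * 48 + 15) + 3 * suc n
    ≡⟨ regroup (pairSum (n * 6) distance) n ⟩
  pairSum (n * 6) distance + 3 * n + (n * n * 36 + n * 48 + 18)
    ≡⟨ cong (_+ (n * n * 36 + n * 48 + 18)) (wiener n) ⟩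
  n * n * n * 12 + n * n * 6 + (n * n * 36 + n * 48 + 18)
    ≡⟨ cube n ⟩
  suc n * suc n * suc n * 12 + suc n * suc n * 6 ∎
  where
  open ≡-Reasoning
  regroup : ∀ a n → a + (n * n * 36 + n * 48 + 15) + 3 * suc n ≡ a + 3 * n + (n * n * 36 + n * 48 + 18)
  regroup = solve-∀
  cube : ∀ n → n * n * n * 12 + n * n * 6 + (n * n * 36 + n * 48 + 18) ≡ suc n * suc n * suc n * 12 + suc n * suc n * 6
  cube = solve-∀

-- The right-hand side is 12 * n ^ 3 + 6 * n ^ 2 unfolded: the ring solver does not parse _^_ here.
powers : ∀ n → n * n * n * 12 + n * n * 6 ≡ 12 * (n * (n * (n * 1))) + 6 * (n * (n * 1))
powers = solve-∀

proposition4p4 : ∀ (n : ℕ) → 2 ≤ n →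
    Σ (ℕ → ℕ → ℕ) (λ dist →
      (∀ u v → 1 ≤ u → u < v → v ≤ 6 * n → IsDistance (LP n) u v (dist u v))
      × (pairSum (6 * n) dist ≡ 12 * n ^ 3 + 6 * n ^ 2 ∸ 3 * n))
proposition4p4 n _ = distance , is-distance , sum
  where
  open ≡-Reasoning

  is-distance : ∀ u v → 1 ≤ u → u < v → v ≤ 6 * n → IsDistance (LP n) u v (distance u v)
  is-distance u v 1≤u u<v v≤6n =
    distance-path n 1≤u u<v (subst (v ≤_) (*-comm 6 n) v≤6n) , λ _ → distance-minimal u<v

  sum : pairSum (6 * n) distance ≡ 12 * n ^ 3 + 6 * n ^ 2 ∸ 3 * n
  sum = begin
    pairSum (6 * n) distance                  ≡⟨ cong (λ N → pairSum N distance) (*-comm 6 n) ⟩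
    pairSum (n * 6) distance                  ≡⟨ m+n∸n≡m _ (3 * n) ⟨
    pairSum (n * 6) distance + 3 * n ∸ 3 * n  ≡⟨ cong (_∸ 3 * n) (trans (wiener n) (powers n)) ⟩
    12 * n ^ 3 + 6 * n ^ 2 ∸ 3 * n            ∎
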